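{- Let $R$ be an integral domain with field of fractions $K$, and let $A$ be a nonempty finite subset of $K^\times$. Then $A\vdash_{\mathrm d}1$ holds if and only if $1\in\langle A\rangle_{R[A]}$, where $R[A]$ is the subring of $K$ generated by $R$ and $A$.
   Context: $G=K^\times/R^\times$ is the divisibility group, written multiplicatively, ordered by $a\le b$ iff $b/a\in R$; its elements are represented by elements of $K^\times$. For a nonempty finite $A=\{a_1,\dots,a_k\}\subseteq K^\times$ and a subring $S\supseteq R$ of $K$, $\langle A\rangle_S=Sa_1+\dots+Sa_k$. The system of Dedekind ideals is $A\rhd_{\mathrm d}b$ iff $b\in\langle A\rangle_R$. A system of ideals for $G$ is a relation $\rhd$ between nonempty finite subsets of $G$ and $G$ with $a\rhd a$; $A\rhd b\Rightarrow A\cup A'\rhd b$; ($A\rhd c$ and $A\cup\{c\}\rhd b$) $\Rightarrow A\rhd b$; $a\le b\Rightarrow a\rhd b$; $A\rhd b\Rightarrow yA\rhd yb$. For $y_1,\dots,y_n\in G$, $(\rhd_{\mathrm d})_{y_1,\dots,y_n}$ is the finest system of ideals containing $\rhd_{\mathrm d}$ with $1\,(\rhd_{\mathrm d})_{y_1,\dots,y_n}\,y_i$ for all $i$. The regularisation $\vdash_{\mathrm d}$ of $\rhd_{\mathrm d}$ is: $A\vdash_{\mathrm d}B$ iff there exist $x_1,\dots,x_m\in K^\times$ such that $AB^{ -1}\,(\rhd_{\mathrm d})_{x_1^{\pm1},\dots,x_m^{\pm1}}\,1$ for every choice of signs, where $AB^{ -1}=\{ab^{ -1}:a\in A,b\in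 B\}$. -}

module Defs where

open import Level using (Level; _⊔_; suc)
open import Algebra.Bundles using (CommutativeRing)
open import Data.List using (List; []; _∷_; map; zipWith; foldr; length)
open import Data.List.Relation.Unary.All using (All)
open import Data.List.Membership.Propositional using (_∈_)
open import Data.Product using (Σ; _×_; ∃; _,_; proj₁; proj₂)
open import Relation.Nullary using (¬_)
open import Relation.Binary.PropositionalEquality using (_≡_)

-- K is a field (commutative ring, 1 ≠ 0, nonzero elements invertible);
-- R ⊆ K is a subring (hence an integral domain), and every element of K
-- is a quotient a/b of elements of R with b ≠ 0 (written x * b ≈ a).
record FracField (c ℓ r : Level) : Set (suc (c ⊔ ℓ ⊔ r)) where
  field
    K : CommutativeRing c ℓ
  open CommutativeRing K public
  field
    1≉0      : ¬ (1# ≈ 0#)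
    inverse  : ∀ x → ¬ (x ≈ 0#) → ∃ λ y → x * y ≈ 1#
    R        : Carrier → Set r
    R-resp   : ∀ {x y} → x ≈ y → R x → R y
    R-0      : R 0#
    R-1      : R 1#
    R-+      : ∀ {x y} → R x → R y → R (x + y)
    R-*      : ∀ {x y} → R x → R y → R (x * y)
    R--      : ∀ {x} → R x → R (- x)
    fraction : ∀ x → Σ Carrier λ a → Σ Carrier λ b →
                 R a × R b × ¬ (b ≈ 0#) × (x * b ≈ a)

module _ {c ℓ r : Level} (F : FracField c ℓ r) where
  open FracField F

  -- elements of K^× (representatives of elements of G = K^×/R^×)
  NZ : Carrier → Set ℓ
  NZ x = ¬ (x ≈ 0#)

  _≤G_ : Carrier → Carrier → Set (ℓ ⊔ c ⊔ r)
  a ≤G b = ∃ λ s → R s × (b ≈ s * a)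

  lincomb : List Carrier → List Carrier → Carrier
  lincomb cs as = foldr _+_ 0# (zipWith _*_ cs as)

  InSpan : ∀ {s} → (Carrier → Set s) → List Carrier → Carrier → Set (c ⊔ ℓ ⊔ s)
  InSpan S A b = ∃ λ cs → length cs ≡ length A × All S cs × (b ≈ lincomb cs A)

  _▷d_ : List Carrier → Carrier → Set (c ⊔ ℓ ⊔ r)
  A ▷d b = InSpan R A b

  data RAdj (A : List Carrier) : Carrier → Set (c ⊔ ℓ ⊔ r) where
    base : ∀ {x} → R x → RAdj A x
    gen  : ∀ {x} → x ∈ A → RAdj A x
    add  : ∀ {x y} → RAdj A x → RAdj A y → RAdj A (x + y)
    mul  : ∀ {x y} → RAdj A x → RAdj A y → RAdj A (x * y)
    neg  : ∀ {x} → RAdj A x → RAdj A (- x)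
    resp : ∀ {x y} → x ≈ y → RAdj A x → RAdj A y

  -- (▷d)_{y₁,…,yₙ}: the finest system of ideals (on nonempty finite subsets
  -- of K^×, i.e. of G, represented by lists) containing ▷d and with 1 ▷ yᵢ.
  data Sys (ys : List Carrier) : List Carrier → Carrier → Set (c ⊔ ℓ ⊔ r) where
    ded    : ∀ {A b} → ¬ (A ≡ []) → All NZ A → NZ b → A ▷d b → Sys ys A b
    gens   : ∀ {y} → NZ y → y ∈ ys → Sys ys (1# ∷ []) y
    refl▷  : ∀ {a} → NZ a → Sys ys (a ∷ []) a
    -- A ▷ b ⇒ A ∪ A' ▷ b  (stated as: A ⊆ A' ⇒ A' ▷ b)
    weak   : ∀ {A A' b} → All NZ A' → (∀ {x} → x ∈ A → x ∈ A') →
               Sys ys A b → Sys ys A' b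
    cut    : ∀ {A b c} → Sys ys A c → Sys ys (c ∷ A) b → Sys ys A b
    ≤⇒▷    : ∀ {a b} → NZ a → NZ b → a ≤G b → Sys ys (a ∷ []) b
    transl : ∀ {A b y} → NZ y → Sys ys A b → Sys ys (map (y *_) A) (y * b)

  -- a choice of signs: ys = (x₁^{±1}, …, xₘ^{±1}) where each pair (x , x')
  -- in xs satisfies x * x' ≈ 1, i.e. x' = x⁻¹.
  data Signs : List (Carrier × Carrier) → List Carrier → Set (c ⊔ ℓ) where
    []   : Signs [] []
    pos  : ∀ {x x' xs ys} → Signs xs ys → Signs ((x , x') ∷ xs) (x ∷ ys)
    neg' : ∀ {x x' xs ys} → Signs xs ys → Signs ((x , x') ∷ xs) (x' ∷ ys)

  Inverses : List (Carrier × Carrier) → Set (c ⊔ ℓ)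
  Inverses xs = All (λ p → proj₁ p * proj₂ p ≈ 1#) xs

  -- A ⊢d B specialised to B = {1}: then AB⁻¹ = A, and
  -- A ⊢d 1 iff ∃ x₁,…,xₘ ∈ K^× with A (▷d)_{x₁^{±1},…,xₘ^{±1}} 1 for all signs.
  _⊢d1 : List Carrier → Set (c ⊔ ℓ ⊔ r)
  A ⊢d1 = ∃ λ (xs : List (Carrier × Carrier)) → Inverses xs ×
            (∀ ys → Signs xs ys → Sys ys A 1#)

-- The forward direction is a descent on the signs.  Every rule of (▷d)_{y₁,…,yₙ} preserves
-- b ∈ ⟨B⟩_T for any subring T ⊇ R containing the yᵢ, so each choice of signs gives
-- 1 ∈ ⟨A⟩_{R[A][x₁^{±1},…,xₘ^{±1}]}.  One sign is removed at a time using the ideal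
-- I = ⟨A⟩_S of a subring S ⊇ A: if 1 = f(x) and 1 = g(x⁻¹) with coefficients in I, the one of
-- larger degree can be lowered by means of the other, until one of them is constant and 1 ∈ I.
--
-- For the converse take the xᵢ to be the elements of A.  A choice of signs containing some a⁻¹
-- gives A ▷ a ▷ a·a⁻¹ = 1.  In the all-positive choice 1 ▷ a for every a ∈ A, so every element
-- of R[A] is an R-combination of monomials m with 1 ▷ m; hence 1 = Σ rⱼ mⱼ aⱼ with A ▷ mⱼ aⱼ,
-- and one Dedekind step followed by cuts gives A ▷ 1.

module Submission where

open import Level using (Level) renaming (_⊔_ to _⊔ˡ_)
open import Data.Nat using (ℕ; zero; suc; _≤_; z≤n; s≤s; _≤?_; _⊔_)
open import Data.Nat.Properties using (suc-injective; ≰⇒>; <⇒≤; m≤m⊔n; m≤n⊔m)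
open import Data.List using (List; []; _∷_; map; _++_; cartesianProductWith)
open import Data.List.Relation.Unary.All using (All; []; _∷_)
import Data.List.Relation.Unary.All as All
open import Data.List.Relation.Unary.All.Properties using (++⁺)
open import Data.List.Relation.Unary.Any using (here; there)
open import Data.List.Membership.Propositional using (_∈_)
open import Data.List.Membership.Propositional.Properties
  using (∈-++⁺ˡ; ∈-++⁺ʳ; ∈-map⁺; ∈-cartesianProductWith⁺; ∈-cartesianProductWith⁻)
open import Data.Empty using (⊥-elim)
open import Data.Product using (_×_; ∃; ∃₂; _,_; proj₁; proj₂)
open import Data.Sum using (_⊎_; inj₁; inj₂)
open import Relation.Nullary using (¬_; yes; no)
open import Relation.Binary.PropositionalEquality as P using (_≡_)
open import Function.Bundles using (_⇔_; mk⇔)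
open import Algebra.Bundles using (Semiring)
import Algebra.Solver.Ring.NaturalCoefficients.Default as NaturalCoefficients
open import Defs

All-cartesianProductWith⁺ : ∀ {a b c p} {A : Set a} {B : Set b} {C : Set c} {P : C → Set p}
  (f : A → B → C) xs ys → (∀ {x y} → x ∈ xs → y ∈ ys → P (f x y)) →
  All P (cartesianProductWith f xs ys)
All-cartesianProductWith⁺ f xs ys Pf = All.tabulate λ z∈ → from (∈-cartesianProductWith⁻ f xs ys z∈)
  where
  from : ∀ {z} → ∃₂ (λ x y → x ∈ xs × y ∈ ys × z ≡ f x y) → _
  from (_ , _ , x∈ , y∈ , P.refl) = Pf x∈ y∈

module _ {c ℓ r : Level} (F : FracField c ℓ r) where
  open FracField F hiding (zero)
  open NaturalCoefficients commutativeSemiring using (solve; _:=_; _:+_; _:*_; con)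
  open import Algebra.Definitions.RawSemiring (Semiring.rawSemiring semiring) using (_^_)
  open import Algebra.Properties.Ring ring using (-1*x≈-x)
  open import Algebra.Properties.Group +-group using (\\-leftDividesˡ; \\-leftDividesʳ)
  open import Relation.Binary.Reasoning.Setoid setoid

  -- S[x] and S[y₁,…,yₙ] are defined by recursion, so they are kept at the one level of R[A].
  ℓ′ : Level
  ℓ′ = c ⊔ˡ ℓ ⊔ˡ r

  record IsAdditiveSubmonoid {q} (Q : Carrier → Set q) : Set (c ⊔ˡ ℓ ⊔ˡ q) where
    field
      ∈-resp   : ∀ {x y} → x ≈ y → Q x → Q y
      0∈       : Q 0#
      +-closed : ∀ {x y} → Q x → Q y → Q (x + y)

  record IsSubring {s} (S : Carrier → Set s) : Set (c ⊔ˡ ℓ ⊔ˡ s) where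
    field
      isAdditiveSubmonoid : IsAdditiveSubmonoid S
      1∈       : S 1#
      *-closed : ∀ {x y} → S x → S y → S (x * y)
      -‿closed : ∀ {x} → S x → S (- x)
    open IsAdditiveSubmonoid isAdditiveSubmonoid public

  record IsIdeal {s i} (S : Carrier → Set s) (I : Carrier → Set i) : Set (c ⊔ˡ ℓ ⊔ˡ s ⊔ˡ i) where
    field
      isAdditiveSubmonoid : IsAdditiveSubmonoid I
      ⊆-S       : ∀ {x} → I x → S x
      *-closedˡ : ∀ {s x} → S s → I x → I (s * x)
    open IsAdditiveSubmonoid isAdditiveSubmonoid public

  R-isSubring : IsSubring R
  R-isSubring = record
    { isAdditiveSubmonoid = record { ∈-resp = R-resp ; 0∈ = R-0 ; +-closed = R-+ }
    ; 1∈ = R-1 ; *-closed = R-* ; -‿closed = R-- }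

  RAdj-isSubring : ∀ A → IsSubring (RAdj F A)
  RAdj-isSubring A = record
    { isAdditiveSubmonoid = record { ∈-resp = resp ; 0∈ = base R-0 ; +-closed = add }
    ; 1∈ = base R-1 ; *-closed = mul ; -‿closed = neg }

  span-mono : ∀ {s s′} {S : Carrier → Set s} {S′ : Carrier → Set s′} {B b} →
              (∀ {x} → S x → S′ x) → InSpan F S B b → InSpan F S′ B b
  span-mono S⊆S′ (cs , len , Scs , b≈) = cs , len , All.map S⊆S′ Scs , b≈

  module SpanProperties {s} {S : Carrier → Set s} (S-sub : IsSubring S) where
    open IsSubring S-sub

    span-resp : ∀ {B b b′} → b ≈ b′ → InSpan F S B b → InSpan F S B b′
    span-resp b≈b′ (cs , len , Scs , b≈) = cs , len , Scs , trans (sym b≈b′) b≈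

    span-[] : ∀ {b} → InSpan F S [] b → b ≈ 0#
    span-[] ([] , _ , _ , b≈0) = b≈0

    span-uncons : ∀ {a B b} → InSpan F S (a ∷ B) b →
                  ∃₂ λ k t → S k × InSpan F S B t × b ≈ k * a + t
    span-uncons ([] , () , _)
    span-uncons {B = B} (k ∷ cs , len , Sk ∷ Scs , b≈) =
      k , lincomb F cs B , Sk , (cs , suc-injective len , Scs , refl) , b≈

    span-cons : ∀ {a B k t} → S k → InSpan F S B t → InSpan F S (a ∷ B) (k * a + t)
    span-cons Sk (cs , len , Scs , t≈) = _ ∷ cs , P.cong suc len , Sk ∷ Scs , +-cong refl t≈

    span-0 : ∀ {B} → InSpan F S B 0#
    span-0 {[]}    = [] , P.refl , [] , refl
    span-0 {a ∷ B} = span-resp (trans (+-identityʳ _) (zeroˡ a)) (span-cons 0∈ span-0)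

    span-+ : ∀ {B b b′} → InSpan F S B b → InSpan F S B b′ → InSpan F S B (b + b′)
    span-+ {[]} h h′ = span-resp (sym (trans (+-cong (span-[] h) (span-[] h′)) (+-identityʳ 0#))) span-0
    span-+ {a ∷ B} h h′ with span-uncons h | span-uncons h′
    ... | k , t , Sk , ht , b≈ | k′ , t′ , Sk′ , ht′ , b′≈ =
      span-resp (sym (trans (+-cong b≈ b′≈) (regroup k a t k′ t′))) (span-cons (+-closed Sk Sk′) (span-+ ht ht′))
      where
      regroup = solve 5 (λ k a t k′ t′ → (k :* a :+ t) :+ (k′ :* a :+ t′) := (k :+ k′) :* a :+ (t :+ t′)) refl

    span-isAdditiveSubmonoid : ∀ {B} → IsAdditiveSubmonoid (InSpan F S B)
    span-isAdditiveSubmonoid = record { ∈-resp = span-resp ; 0∈ = span-0 ; +-closed = span-+ }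

    span-∈* : ∀ {B k a} → S k → a ∈ B → InSpan F S B (k * a)
    span-∈* Sk (here P.refl) = span-resp (+-identityʳ _) (span-cons Sk span-0)
    span-∈* {a′ ∷ _} Sk (there a∈) = span-resp (trans (+-cong (zeroˡ a′) refl) (+-identityˡ _)) (span-cons 0∈ (span-∈* Sk a∈))

    span-∈ : ∀ {B a} → a ∈ B → InSpan F S B a
    span-∈ a∈ = span-resp (*-identityˡ _) (span-∈* 1∈ a∈)

    span-elim : ∀ {q} {Q : Carrier → Set q} → IsAdditiveSubmonoid Q → ∀ {B} →
                (∀ {k a} → S k → a ∈ B → Q (k * a)) → ∀ {b} → InSpan F S B b → Q b
    span-elim Q-add {[]} on-gen h = Q.∈-resp (sym (span-[] h)) Q.0∈
      where module Q = IsAdditiveSubmonoid Q-add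
    span-elim Q-add {a ∷ B} on-gen h with span-uncons h
    ... | k , t , Sk , ht , b≈ =
      Q.∈-resp (sym b≈) (Q.+-closed (on-gen Sk (here P.refl)) (span-elim Q-add (λ Sk′ a∈ → on-gen Sk′ (there a∈)) ht))
      where module Q = IsAdditiveSubmonoid Q-add

    scaled-span-isAdditiveSubmonoid : ∀ {B} m → IsAdditiveSubmonoid (λ w → InSpan F S B (m * w))
    scaled-span-isAdditiveSubmonoid m = record
      { ∈-resp   = λ w≈w′ → span-resp (*-cong refl w≈w′)
      ; 0∈       = span-resp (sym (zeroʳ m)) span-0
      ; +-closed = λ h h′ → span-resp (sym (distribˡ m _ _)) (span-+ h h′)
      }

    span-smul : ∀ {B k b} → S k → InSpan F S B b → InSpan F S B (k * b)
    span-smul {k = k} Sk = span-elim (scaled-span-isAdditiveSubmonoid k) λ {k′} {a} Sk′ a∈ →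
      span-resp (*-assoc k k′ a) (span-∈* (*-closed Sk Sk′) a∈)

    span-mul : ∀ {N P m w} → (∀ {n} → n ∈ N → InSpan F S P (m * n)) → InSpan F S N w → InSpan F S P (m * w)
    span-mul {m = m} f = span-elim (scaled-span-isAdditiveSubmonoid m) λ {k} {n} Sk n∈ →
      span-resp (solve 3 (λ k m n → k :* (m :* n) := m :* (k :* n)) refl k m n) (span-smul Sk (f n∈))

    span-bilinear : ∀ {M N P v w} → (∀ {m n} → m ∈ M → n ∈ N → InSpan F S P (m * n)) →
                    InSpan F S M v → InSpan F S N w → InSpan F S P (v * w)
    span-bilinear {w = w} f hv hw =
      span-resp (*-comm w _) (span-mul (λ m∈ → span-resp (*-comm _ w) (span-mul (f m∈) hw)) hv)

    span-trans : ∀ {B B′ b} → (∀ {x} → x ∈ B → InSpan F S B′ x) → InSpan F S B b → InSpan F S B′ b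
    span-trans f = span-elim span-isAdditiveSubmonoid λ Sk a∈ → span-smul Sk (f a∈)

    span-⊆ : ∀ {B b} → (∀ {a} → a ∈ B → S a) → InSpan F S B b → S b
    span-⊆ B⊆S = span-elim isAdditiveSubmonoid λ Sk a∈ → *-closed Sk (B⊆S a∈)

    span-isIdeal : ∀ {B} → (∀ {a} → a ∈ B → S a) → IsIdeal S (InSpan F S B)
    span-isIdeal B⊆S = record
      { isAdditiveSubmonoid = span-isAdditiveSubmonoid ; ⊆-S = span-⊆ B⊆S ; *-closedˡ = span-smul }

  Poly : (Carrier → Set ℓ′) → Carrier → ℕ → Carrier → Set ℓ′
  Poly Q x zero    v = Q v
  Poly Q x (suc n) v = ∃₂ λ p w → Q p × Poly Q x n w × v ≈ p + x * w

  -- For a subring S this is the ring S[x]; for an ideal I of S it is the ideal I·S[x].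
  _[_] : (Carrier → Set ℓ′) → Carrier → Carrier → Set ℓ′
  (Q [ x ]) v = ∃ λ n → Poly Q x n v

  []-⊇ : ∀ {Q x v} → Q v → (Q [ x ]) v
  []-⊇ Qv = zero , Qv

  poly-map : ∀ {Q Q′ x k} → (∀ {v} → Q v → Q′ (k * v)) → ∀ n {v} → Poly Q x n v → Poly Q′ x n (k * v)
  poly-map f zero Qv = f Qv
  poly-map {x = x} {k} f (suc n) (p , w , Qp , pw , v≈) =
    k * p , k * w , f Qp , poly-map f n pw ,
    trans (*-cong refl v≈) (solve 4 (λ k p x w → k :* (p :+ x :* w) := k :* p :+ x :* (k :* w)) refl k p x w)

  module PolyProperties {Q : Carrier → Set ℓ′} (Q-add : IsAdditiveSubmonoid Q) (x : Carrier) where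
    open IsAdditiveSubmonoid Q-add

    poly-resp : ∀ n {v v′} → v ≈ v′ → Poly Q x n v → Poly Q x n v′
    poly-resp zero    v≈v′ Qv = ∈-resp v≈v′ Qv
    poly-resp (suc n) v≈v′ (p , w , Qp , pw , v≈) = p , w , Qp , pw , trans (sym v≈v′) v≈

    private
      +x*0 : ∀ v → v ≈ v + x * 0#
      +x*0 v = sym (trans (+-cong refl (zeroʳ x)) (+-identityʳ v))

    poly-const : ∀ n {v} → Q v → Poly Q x n v
    poly-const zero    Qv = Qv
    poly-const (suc n) Qv = _ , 0# , Qv , poly-const n 0∈ , +x*0 _

    poly-suc : ∀ n {v} → Poly Q x n v → Poly Q x (suc n) v
    poly-suc zero    Qv = _ , 0# , Qv , 0∈ , +x*0 _
    poly-suc (suc n) (p , w , Qp , pw , v≈) = p , w , Qp , poly-suc n pw , v≈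

    poly-≤ : ∀ {m n v} → m ≤ n → Poly Q x m v → Poly Q x n v
    poly-≤ {zero} {zero}  z≤n pv = pv
    poly-≤ {zero} {suc n} z≤n pv = poly-suc n (poly-≤ {n = n} z≤n pv)
    poly-≤ {suc m} {suc n} (s≤s m≤n) (p , w , Qp , pw , v≈) = p , w , Qp , poly-≤ m≤n pw , v≈

    poly-+ : ∀ n {v v′} → Poly Q x n v → Poly Q x n v′ → Poly Q x n (v + v′)
    poly-+ zero Qv Qv′ = +-closed Qv Qv′
    poly-+ (suc n) (p , w , Qp , pw , v≈) (p′ , w′ , Qp′ , pw′ , v′≈) =
      p + p′ , w + w′ , +-closed Qp Qp′ , poly-+ n pw pw′ ,
      trans (+-cong v≈ v′≈) (solve 5 (λ p x w p′ w′ → (p :+ x :* w) :+ (p′ :+ x :* w′) := (p :+ p′) :+ x :* (w :+ w′)) refl p x w p′ w′)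

    poly-monomial : ∀ n {q} → Q q → Poly Q x n (q * x ^ n)
    poly-monomial zero    Qq = ∈-resp (sym (*-identityʳ _)) Qq
    poly-monomial (suc n) {q} Qq = 0# , q * x ^ n , 0∈ , poly-monomial n Qq ,
      solve 3 (λ q x X → q :* (x :* X) := con 0 :+ x :* (q :* X)) refl q x (x ^ n)

    poly-split-top : ∀ n {v} → Poly Q x (suc n) v → ∃₂ λ p w → Q p × Poly Q x n w × v ≈ w + p * x ^ suc n
    poly-split-top zero (p₀ , w , Qp₀ , Qw , v≈) =
      w , p₀ , Qw , Qp₀ , trans v≈ (solve 3 (λ p₀ x w → p₀ :+ x :* w := p₀ :+ w :* (x :* con 1)) refl p₀ x w)
    poly-split-top (suc n) (p₀ , w , Qp₀ , pw , v≈) with poly-split-top n pw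
    ... | p , w′ , Qp , pw′ , w≈ = p , p₀ + x * w′ , Qp , (p₀ , w′ , Qp₀ , pw′ , refl) , (begin
      _                              ≈⟨ v≈ ⟩
      p₀ + x * w                     ≈⟨ +-cong refl (*-cong refl w≈) ⟩
      p₀ + x * (w′ + p * x ^ suc n)  ≈⟨ solve 5 (λ p₀ x w′ p X → p₀ :+ x :* (w′ :+ p :* X) := (p₀ :+ x :* w′) :+ p :* (x :* X)) refl p₀ x w′ p (x ^ suc n) ⟩
      (p₀ + x * w′) + p * x ^ suc (suc n) ∎)

    poly-shift : ∀ {x′} → x * x′ ≈ 1# → ∀ {m n v} → m ≤ n → Poly Q x′ m v → Poly Q x n (x ^ n * v)
    poly-shift x*x′≈1 {zero} {n} z≤n Qv = poly-resp n (*-comm _ _) (poly-monomial n Qv)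
    poly-shift {x′} x*x′≈1 {suc m} {suc n} {v} (s≤s m≤n) (q , w , Qq , pw , v≈) =
      poly-resp (suc n) (sym x^[n+1]*v≈) (poly-+ (suc n) (poly-monomial (suc n) Qq) (poly-suc n (poly-shift x*x′≈1 m≤n pw)))
      where
      X = x ^ n
      x^[n+1]*v≈ : (x * X) * v ≈ q * (x * X) + X * w
      x^[n+1]*v≈ = begin
        (x * X) * v                      ≈⟨ *-cong refl v≈ ⟩
        (x * X) * (q + x′ * w)           ≈⟨ solve 5 (λ x X q x′ w → (x :* X) :* (q :+ x′ :* w) := q :* (x :* X) :+ (x :* x′) :* (X :* w)) refl x X q x′ w ⟩
        q * (x * X) + (x * x′) * (X * w) ≈⟨ +-cong refl (trans (*-cong x*x′≈1 refl) (*-identityˡ _)) ⟩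
        q * (x * X) + X * w              ∎

    []-isAdditiveSubmonoid : IsAdditiveSubmonoid (Q [ x ])
    []-isAdditiveSubmonoid = record
      { ∈-resp   = λ { v≈v′ (n , pv) → n , poly-resp n v≈v′ pv }
      ; 0∈       = []-⊇ 0∈
      ; +-closed = λ { (n , pv) (m , pv′) → n ⊔ m , poly-+ (n ⊔ m) (poly-≤ (m≤m⊔n n m) pv) (poly-≤ (m≤n⊔m n m) pv′) }
      }

    x*-closed : ∀ {v} → (Q [ x ]) v → (Q [ x ]) (x * v)
    x*-closed (n , pv) = suc n , 0# , _ , 0∈ , pv , sym (+-identityˡ _)

  module AdjoinProperties {S : Carrier → Set ℓ′} (S-sub : IsSubring S) (x : Carrier) where
    open IsSubring S-sub
    open PolyProperties isAdditiveSubmonoid x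

    poly-* : ∀ n m {v w} → Poly S x n v → Poly S x m w → (S [ x ]) (v * w)
    poly-* zero    m Sv pw = m , poly-map (*-closed Sv) m pw
    poly-* (suc n) m {v} {w} (p , v′ , Sp , pv′ , v≈) pw =
      IsAdditiveSubmonoid.∈-resp []-isAdditiveSubmonoid (sym v*w≈)
        (IsAdditiveSubmonoid.+-closed []-isAdditiveSubmonoid
          (m , poly-map (*-closed Sp) m pw) (x*-closed (poly-* n m pv′ pw)))
      where
      v*w≈ : v * w ≈ p * w + x * (v′ * w)
      v*w≈ = trans (*-cong v≈ refl) (solve 4 (λ p x v′ w → (p :+ x :* v′) :* w := p :* w :+ x :* (v′ :* w)) refl p x v′ w)

    []-isSubring : IsSubring (S [ x ])
    []-isSubring = record
      { isAdditiveSubmonoid = []-isAdditiveSubmonoid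
      ; 1∈       = []-⊇ 1∈
      ; *-closed = λ { (n , pv) (m , pw) → poly-* n m pv pw }
      ; -‿closed = λ { (n , pv) → n , poly-resp n (-1*x≈-x _) (poly-map (*-closed (-‿closed 1∈)) n pv) }
      }

    []-∋ : (S [ x ]) x
    []-∋ = suc zero , 0# , 1# , 0∈ , 1∈ , trans (sym (*-identityʳ x)) (sym (+-identityˡ _))

  _[_]* : (Carrier → Set ℓ′) → List Carrier → Carrier → Set ℓ′
  S [ []     ]* = S
  S [ y ∷ ys ]* = (S [ y ]) [ ys ]*

  []*-isSubring : ∀ {S} → IsSubring S → ∀ ys → IsSubring (S [ ys ]*)
  []*-isSubring S-sub []       = S-sub
  []*-isSubring S-sub (y ∷ ys) = []*-isSubring (AdjoinProperties.[]-isSubring S-sub y) ys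

  []*-⊇ : ∀ {S : Carrier → Set ℓ′} ys {v} → S v → (S [ ys ]*) v
  []*-⊇ []       Sv = Sv
  []*-⊇ (y ∷ ys) Sv = []*-⊇ ys ([]-⊇ Sv)

  []*-∋ : ∀ {S} → IsSubring S → ∀ ys {y} → y ∈ ys → (S [ ys ]*) y
  []*-∋ S-sub (y ∷ ys) (here P.refl) = []*-⊇ ys (AdjoinProperties.[]-∋ S-sub y)
  []*-∋ S-sub (y ∷ ys) (there y∈)    = []*-∋ (AdjoinProperties.[]-isSubring S-sub y) ys y∈

  module IdealProperties {S I : Carrier → Set ℓ′} (S-sub : IsSubring S) (I-ideal : IsIdeal S I) where
    open IsIdeal I-ideal
    private
      module S = IsSubring S-sub
      module Poly x = PolyProperties isAdditiveSubmonoid x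

    -- With t = 1 − q = x⁻¹w′ ∈ S one gets 1 = q + t(w + p xⁿ⁺¹) = q + tw + p xⁿw′,
    -- and xⁿw′ is a polynomial in x of degree ≤ n because deg w′ ≤ m ≤ n.
    poly-reduce-degree : ∀ {x x′} → x * x′ ≈ 1# → ∀ {m n} → m ≤ n →
                         Poly I x (suc n) 1# → Poly I x′ (suc m) 1# → Poly I x n 1#
    poly-reduce-degree {x} {x′} x*x′≈1 {m} {n} m≤n pv (q , w′ , Iq , pw′ , 1≈q+x′w′)
      with Poly.poly-split-top x n pv
    ... | p , w , Ip , pw , 1≈w+pxⁿ⁺¹ =
      Poly.poly-resp x n (sym 1≈) (Poly.poly-+ x n (Poly.poly-const x n Iq) (Poly.poly-+ x n
        (poly-map (*-closedˡ St) n pw)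
        (poly-map (*-closedˡ (⊆-S Ip)) n (Poly.poly-shift x x*x′≈1 m≤n pw′))))
      where
      t = - q + 1#
      St : S t
      St = S.+-closed (S.-‿closed (⊆-S Iq)) S.1∈
      x*t≈w′ : x * t ≈ w′
      x*t≈w′ = begin
        x * (- q + 1#)            ≈⟨ *-cong refl (+-cong refl 1≈q+x′w′) ⟩
        x * (- q + (q + x′ * w′)) ≈⟨ *-cong refl (\\-leftDividesʳ q (x′ * w′)) ⟩
        x * (x′ * w′)             ≈⟨ sym (*-assoc x x′ w′) ⟩
        (x * x′) * w′             ≈⟨ trans (*-cong x*x′≈1 refl) (*-identityˡ w′) ⟩
        w′                        ∎
      1≈ : 1# ≈ q + (t * w + p * (x ^ n * w′))
      1≈ = begin
        1#                                  ≈⟨ sym (\\-leftDividesˡ q 1#) ⟩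
        q + t                               ≈⟨ +-cong refl (sym (*-identityʳ t)) ⟩
        q + t * 1#                          ≈⟨ +-cong refl (*-cong refl 1≈w+pxⁿ⁺¹) ⟩
        q + t * (w + p * (x * x ^ n))       ≈⟨ solve 6 (λ q t w p x X → q :+ t :* (w :+ p :* (x :* X)) := q :+ (t :* w :+ p :* (X :* (x :* t)))) refl q t w p x (x ^ n) ⟩
        q + (t * w + p * (x ^ n * (x * t))) ≈⟨ +-cong refl (+-cong refl (*-cong refl (*-cong refl x*t≈w′))) ⟩
        q + (t * w + p * (x ^ n * w′))      ∎

    1∈I[x]→1∈I[x⁻¹]→1∈I : ∀ {x x′} → x * x′ ≈ 1# → (I [ x ]) 1# → (I [ x′ ]) 1# → I 1#
    1∈I[x]→1∈I[x⁻¹]→1∈I {x} {x′} x*x′≈1 (n , pv) (m , pv′) = go n m pv pv′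
      where
      x′*x≈1 : x′ * x ≈ 1#
      x′*x≈1 = trans (*-comm x′ x) x*x′≈1
      go : ∀ n m → Poly I x n 1# → Poly I x′ m 1# → I 1#
      go zero    m       pv pv′ = pv
      go (suc n) zero    pv pv′ = pv′
      go (suc n) (suc m) pv pv′ with m ≤? n
      ... | yes m≤n = go n (suc m) (poly-reduce-degree x*x′≈1 m≤n pv pv′) pv′
      ... | no  m≰n = go (suc n) m pv (poly-reduce-degree x′*x≈1 (<⇒≤ (≰⇒> m≰n)) pv′ pv)

  span-[]⇒[]-span : ∀ {S : Carrier → Set ℓ′} → IsSubring S → ∀ {A x b} →
                    InSpan F (S [ x ]) A b → (InSpan F S A [ x ]) b
  span-[]⇒[]-span {S} S-sub {A} {x} = S[x].span-elim (PolyProperties.[]-isAdditiveSubmonoid span-isAdditiveSubmonoid x)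
    λ { {k} {a} (n , pk) a∈ → n ,
          PolyProperties.poly-resp span-isAdditiveSubmonoid x n (*-comm a k)
            (poly-map (λ Ss → span-resp (*-comm _ a) (span-∈* Ss a∈)) n pk) }
    where
    open SpanProperties S-sub
    module S[x] = SpanProperties (AdjoinProperties.[]-isSubring S-sub x)

  1∈⟨A⟩[x]→1∈⟨A⟩[x⁻¹]→1∈⟨A⟩ : ∀ {S : Carrier → Set ℓ′} → IsSubring S → ∀ {A} → (∀ {a} → a ∈ A → S a) →
    ∀ {x x′} → x * x′ ≈ 1# → InSpan F (S [ x ]) A 1# → InSpan F (S [ x′ ]) A 1# → InSpan F S A 1#
  1∈⟨A⟩[x]→1∈⟨A⟩[x⁻¹]→1∈⟨A⟩ S-sub A⊆S x*x′≈1 h h′ =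
    IdealProperties.1∈I[x]→1∈I[x⁻¹]→1∈I S-sub (SpanProperties.span-isIdeal S-sub A⊆S) x*x′≈1
      (span-[]⇒[]-span S-sub h) (span-[]⇒[]-span S-sub h′)

  eliminate-signs : ∀ {S : Carrier → Set ℓ′} → IsSubring S → ∀ {A} → (∀ {a} → a ∈ A → S a) →
    ∀ {xs} → Inverses F xs → (∀ ys → Signs F xs ys → InSpan F (S [ ys ]*) A 1#) → InSpan F S A 1#
  eliminate-signs S-sub A⊆S [] derive = derive [] []
  eliminate-signs S-sub A⊆S {(x , x′) ∷ _} (x*x′≈1 ∷ inv) derive =
    1∈⟨A⟩[x]→1∈⟨A⟩[x⁻¹]→1∈⟨A⟩ S-sub A⊆S x*x′≈1
      (eliminate-signs (S[ x ]-sub) (λ a∈ → []-⊇ (A⊆S a∈)) inv λ ys signs → derive (x ∷ ys) (pos signs))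
      (eliminate-signs (S[ x′ ]-sub) (λ a∈ → []-⊇ (A⊆S a∈)) inv λ ys signs → derive (x′ ∷ ys) (neg' signs))
    where
    S[_]-sub = AdjoinProperties.[]-isSubring S-sub

  Sys⇒InSpan : ∀ {t} {T : Carrier → Set t} → IsSubring T → (∀ {x} → R x → T x) →
               ∀ {ys} → (∀ {y} → y ∈ ys → T y) → ∀ {B b} → Sys F ys B b → InSpan F T B b
  Sys⇒InSpan T-sub R⊆T ys⊆T = sound
    where
    open SpanProperties T-sub
    sound : ∀ {B b} → Sys F _ B b → InSpan F _ B b
    sound (ded _ _ _ h)              = span-mono R⊆T h
    sound (gens _ y∈)                = span-resp (*-identityʳ _) (span-∈* (ys⊆T y∈) (here P.refl))
    sound (refl▷ _)                  = span-∈ (here P.refl)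
    sound (weak _ B⊆B′ d)            = span-trans (λ x∈ → span-∈ (B⊆B′ x∈)) (sound d)
    sound (cut {A} {c = c} d₁ d₂)     = span-trans cA⊆⟨A⟩ (sound d₂)
      where
      cA⊆⟨A⟩ : ∀ {x} → x ∈ c ∷ A → InSpan F _ A x
      cA⊆⟨A⟩ (here P.refl) = sound d₁
      cA⊆⟨A⟩ (there x∈)    = span-∈ x∈
    sound (≤⇒▷ _ _ (s , Rs , b≈sa))  = span-resp (sym b≈sa) (span-∈* (R⊆T Rs) (here P.refl))
    sound (transl {y = y} _ d)       = span-mul (λ b∈ → span-∈ (∈-map⁺ (y *_) b∈)) (sound d)

  ⊢d1⇒1∈⟨A⟩ : ∀ {A} → _⊢d1 F A → InSpan F (RAdj F A) A 1#
  ⊢d1⇒1∈⟨A⟩ {A} (xs , inv , derive) = eliminate-signs (RAdj-isSubring A) gen inv λ ys signs →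
    Sys⇒InSpan ([]*-isSubring (RAdj-isSubring A) ys) (λ Rx → []*-⊇ ys (base Rx))
      ([]*-∋ (RAdj-isSubring A) ys) (derive ys signs)

  NZ-* : ∀ {a b} → NZ F a → NZ F b → NZ F (a * b)
  NZ-* {a} {b} a≉0 b≉0 ab≈0 with inverse a a≉0
  ... | a⁻¹ , aa⁻¹≈1 = b≉0 (begin
    b               ≈⟨ sym (*-identityˡ b) ⟩
    1# * b          ≈⟨ *-cong (sym aa⁻¹≈1) refl ⟩
    (a * a⁻¹) * b   ≈⟨ solve 3 (λ a a⁻¹ b → (a :* a⁻¹) :* b := a⁻¹ :* (a :* b)) refl a a⁻¹ b ⟩
    a⁻¹ * (a * b)   ≈⟨ *-cong refl ab≈0 ⟩
    a⁻¹ * 0#        ≈⟨ zeroʳ a⁻¹ ⟩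
    0#              ∎)

  inverse-NZ : ∀ {a a′} → a * a′ ≈ 1# → NZ F a′
  inverse-NZ {a} aa′≈1 a′≈0 = 1≉0 (trans (sym aa′≈1) (trans (*-cong refl a′≈0) (zeroʳ a)))

  module Derivations (ys : List Carrier) where
    infix 4 _▷_
    _▷_ : List Carrier → Carrier → Set ℓ′
    _▷_ = Sys F ys

    ▷-≈ : ∀ {u v} → NZ F u → NZ F v → u ≈ v → u ∷ [] ▷ v
    ▷-≈ {u} u≉0 v≉0 u≈v = ≤⇒▷ u≉0 v≉0 (1# , R-1 , trans (sym u≈v) (sym (*-identityˡ u)))

    ▷-from-∈ : ∀ {B u v} → All (NZ F) B → u ∈ B → u ∷ [] ▷ v → B ▷ v
    ▷-from-∈ B≉0 u∈B = weak B≉0 λ { (here P.refl) → u∈B }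

    ▷-trans : ∀ {B u v} → All (NZ F) B → NZ F u → B ▷ u → u ∷ [] ▷ v → B ▷ v
    ▷-trans B≉0 u≉0 B▷u u▷v = cut B▷u (▷-from-∈ (u≉0 ∷ B≉0) (here P.refl) u▷v)

    ▷-*ʳ : ∀ {B m n} → All (NZ F) B → NZ F m → B ▷ m → 1# ∷ [] ▷ n → B ▷ m * n
    ▷-*ʳ B≉0 m≉0 B▷m 1▷n = ▷-trans B≉0 m≉0 B▷m
      (▷-trans (m≉0 ∷ []) m1≉0 (▷-≈ m≉0 m1≉0 (sym (*-identityʳ _))) (transl m≉0 1▷n))
      where
      m1≉0 = NZ-* m≉0 1≉0

    ▷-cut-all : ∀ {B b} M → All (NZ F) M → All (B ▷_) M → All (NZ F) B → M ++ B ▷ b → B ▷ b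
    ▷-cut-all []      _           _           _   d = d
    ▷-cut-all (m ∷ M) (_ ∷ M≉0) (B▷m ∷ B▷M) B≉0 d =
      ▷-cut-all M M≉0 B▷M B≉0 (cut (weak (++⁺ M≉0 B≉0) (∈-++⁺ʳ M) B▷m) d)

    ▷1-of-inverse : ∀ {A a a′} → All (NZ F) A → a ∈ A → a * a′ ≈ 1# → a′ ∈ ys → A ▷ 1#
    ▷1-of-inverse A≉0 a∈A aa′≈1 a′∈ys = ▷-from-∈ A≉0 a∈A
      (▷-trans (a≉0 ∷ []) aa′≉0 (▷-*ʳ (a≉0 ∷ []) a≉0 (refl▷ a≉0) (gens (inverse-NZ aa′≈1) a′∈ys))
        (▷-≈ aa′≉0 1≉0 aa′≈1))
      where
      a≉0 = All.lookup A≉0 a∈A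
      aa′≉0 = NZ-* a≉0 (inverse-NZ aa′≈1)

    open SpanProperties R-isSubring

    ▷Span : List Carrier → Carrier → Set ℓ′
    ▷Span B v = ∃ λ M → All (NZ F) M × All (B ▷_) M × InSpan F R M v

    ▷Span-resp : ∀ {B v v′} → v ≈ v′ → ▷Span B v → ▷Span B v′
    ▷Span-resp v≈v′ (M , M≉0 , B▷M , h) = M , M≉0 , B▷M , span-resp v≈v′ h

    ▷Span-+ : ∀ {B v w} → ▷Span B v → ▷Span B w → ▷Span B (v + w)
    ▷Span-+ (M₁ , M₁≉0 , B▷M₁ , h₁) (M₂ , M₂≉0 , B▷M₂ , h₂) =
      M₁ ++ M₂ , ++⁺ M₁≉0 M₂≉0 , ++⁺ B▷M₁ B▷M₂ ,
      span-+ (span-trans (λ m∈ → span-∈ (∈-++⁺ˡ m∈)) h₁) (span-trans (λ m∈ → span-∈ (∈-++⁺ʳ M₁ m∈)) h₂)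

    ▷Span-isAdditiveSubmonoid : ∀ {B} → IsAdditiveSubmonoid (▷Span B)
    ▷Span-isAdditiveSubmonoid = record { ∈-resp = ▷Span-resp ; 0∈ = [] , [] , [] , span-0 ; +-closed = ▷Span-+ }

    ▷Span-∋ : ∀ {B u} → NZ F u → B ▷ u → ▷Span B u
    ▷Span-∋ u≉0 B▷u = _ ∷ [] , u≉0 ∷ [] , B▷u ∷ [] , span-∈ (here P.refl)

    ▷Span-smul : ∀ {B k v} → R k → ▷Span B v → ▷Span B (k * v)
    ▷Span-smul Rk (M , M≉0 , B▷M , h) = M , M≉0 , B▷M , span-smul Rk h

    ▷Span-* : ∀ {B v w} → All (NZ F) B → ▷Span B v → ▷Span (1# ∷ []) w → ▷Span B (v * w)
    ▷Span-* B≉0 (M , M≉0 , B▷M , hv) (N , N≉0 , 1▷N , hw) =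
      cartesianProductWith _*_ M N ,
      All-cartesianProductWith⁺ _*_ M N (λ m∈ n∈ → NZ-* (All.lookup M≉0 m∈) (All.lookup N≉0 n∈)) ,
      All-cartesianProductWith⁺ _*_ M N (λ m∈ n∈ → ▷-*ʳ B≉0 (All.lookup M≉0 m∈) (All.lookup B▷M m∈) (All.lookup 1▷N n∈)) ,
      span-bilinear (λ m∈ n∈ → span-∈ (∈-cartesianProductWith⁺ _*_ m∈ n∈)) hv hw

    RAdj⇒▷Span : All (NZ F) ys → ∀ {v} → RAdj F ys v → ▷Span (1# ∷ []) v
    RAdj⇒▷Span ys≉0 (base Rv)   = ▷Span-resp (*-identityʳ _) (▷Span-smul Rv (▷Span-∋ 1≉0 (refl▷ 1≉0)))
    RAdj⇒▷Span ys≉0 (gen y∈)    = ▷Span-∋ (All.lookup ys≉0 y∈) (gens (All.lookup ys≉0 y∈) y∈)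
    RAdj⇒▷Span ys≉0 (add g g′)  = ▷Span-+ (RAdj⇒▷Span ys≉0 g) (RAdj⇒▷Span ys≉0 g′)
    RAdj⇒▷Span ys≉0 (mul g g′)  = ▷Span-* (1≉0 ∷ []) (RAdj⇒▷Span ys≉0 g) (RAdj⇒▷Span ys≉0 g′)
    RAdj⇒▷Span ys≉0 (neg g)     = ▷Span-resp (-1*x≈-x _) (▷Span-smul (R-- R-1) (RAdj⇒▷Span ys≉0 g))
    RAdj⇒▷Span ys≉0 (resp e g)  = ▷Span-resp e (RAdj⇒▷Span ys≉0 g)

    ▷Span⇒▷ : ∀ {B} → All (NZ F) B → ▷Span B 1# → B ▷ 1#
    ▷Span⇒▷ B≉0 ([] , _ , _ , h) = ⊥-elim (1≉0 (span-[] h))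
    ▷Span⇒▷ B≉0 (M@(_ ∷ _) , M≉0 , B▷M , h) =
      ▷-cut-all M M≉0 B▷M B≉0 (weak (++⁺ M≉0 B≉0) ∈-++⁺ˡ (ded (λ ()) M≉0 1≉0 h))

    1∈⟨A⟩⇒▷1 : All (NZ F) ys → ∀ {A} → All (NZ F) A → InSpan F (RAdj F ys) A 1# → A ▷ 1#
    1∈⟨A⟩⇒▷1 ys≉0 A≉0 h = ▷Span⇒▷ A≉0 (R[ys].span-elim ▷Span-isAdditiveSubmonoid (λ {k} {a} g a∈ →
      ▷Span-resp (*-comm a k) (▷Span-* A≉0 (▷Span-∋ (All.lookup A≉0 a∈) (▷-from-∈ A≉0 a∈ (refl▷ (All.lookup A≉0 a∈))))
        (RAdj⇒▷Span ys≉0 g))) h)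
      where
      module R[ys] = SpanProperties (RAdj-isSubring ys)

  inversePairs : (A : List Carrier) → All (NZ F) A → List (Carrier × Carrier)
  inversePairs []      []          = []
  inversePairs (a ∷ A) (a≉0 ∷ A≉0) = (a , proj₁ (inverse a a≉0)) ∷ inversePairs A A≉0

  inversePairs-inverses : ∀ A A≉0 → Inverses F (inversePairs A A≉0)
  inversePairs-inverses []      []          = []
  inversePairs-inverses (a ∷ A) (a≉0 ∷ A≉0) = proj₂ (inverse a a≉0) ∷ inversePairs-inverses A A≉0

  signs-inversePairs : ∀ A A≉0 {ys} → Signs F (inversePairs A A≉0) ys →
                       ys ≡ A ⊎ ∃₂ λ a a′ → a ∈ A × a * a′ ≈ 1# × a′ ∈ ys
  signs-inversePairs []      []          []          = inj₁ P.refl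
  signs-inversePairs (a ∷ A) (a≉0 ∷ A≉0) (neg' _)    = inj₂ (a , _ , here P.refl , proj₂ (inverse a a≉0) , here P.refl)
  signs-inversePairs (a ∷ A) (_ ∷ A≉0)   (pos signs) with signs-inversePairs A A≉0 signs
  ... | inj₁ P.refl                          = inj₁ P.refl
  ... | inj₂ (b , b′ , b∈A , bb′≈1 , b′∈ys) = inj₂ (b , b′ , there b∈A , bb′≈1 , there b′∈ys)

  1∈⟨A⟩⇒⊢d1 : ∀ {A} → All (NZ F) A → InSpan F (RAdj F A) A 1# → _⊢d1 F A
  1∈⟨A⟩⇒⊢d1 {A} A≉0 h = inversePairs A A≉0 , inversePairs-inverses A A≉0 , derive
    where
    derive : ∀ ys → Signs F (inversePairs A A≉0) ys → Sys F ys A 1#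
    derive ys signs with signs-inversePairs A A≉0 signs
    ... | inj₁ P.refl                         = Derivations.1∈⟨A⟩⇒▷1 A A≉0 A≉0 h
    ... | inj₂ (a , a′ , a∈A , aa′≈1 , a′∈ys) = Derivations.▷1-of-inverse ys A≉0 a∈A aa′≈1 a′∈ys

lemma4p19 : ∀ {c ℓ r} (F : FracField c ℓ r) (A : List (FracField.Carrier F)) →
    ¬ (A ≡ []) → All (NZ F) A →
    (_⊢d1 F A) ⇔ InSpan F (RAdj F A) A (FracField.1# F)
lemma4p19 F A _ A≉0 = mk⇔ (⊢d1⇒1∈⟨A⟩ F) (1∈⟨A⟩⇒⊢d1 F A≉0)
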